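{- Let $m$, $b$ and $r$ be positive integers. Then \[ \biggl(\sum_{k=0}^{m-1} \left(\mathbf{h}_{krb} - \mathbf{h}_{(kr+1)b}\right)\biggr)^{ -1} = \sum_{L}\mathbf{r}_L, \] where the sum is over all compositions $L$ in which every part is congruent to $0, b, \dots,$ or $(r-1)b$ modulo $mrb$.
   Context: Let $X_1,X_2,\dots$ be noncommuting variables, and work in the ring of formal power series in these variables with integer coefficients. For $n\ge 0$ the complete noncommutative symmetric function is $\mathbf{h}_n=\sum_{i_1\le i_2\le\cdots\le i_n} X_{i_1}X_{i_2}\cdots X_{i_n}$ (so $\mathbf{h}_0=1$). A composition is a finite (possibly empty) sequence of positive integers; a composition of $n$ is one with sum $n$. For a composition $L=(L_1,\dots,L_k)$ of $n$, the ribbon noncommutative symmetric function is $\mathbf{r}_L=\sum X_{i_1}X_{i_2}\cdots X_{i_n}$, summed over all $i_1,\dots,i_n$ with $i_1\le\cdots\le i_{L_1} > i_{L_1+1}\le\cdots\le i_{L_1+L_2} > \cdots > i_{L_1+\cdots+L_{k-1}+1}\le\cdots\le i_n$; i.e., the sum of all words whose maximal weakly increasing runs have lengths $L_1,\dots,L_k$ in order (and $\mathbf{r}_{\emptyset}=1$). -}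

module Defs where

open import Data.Bool using (Bool; true; false; _∧_; if_then_else_)
open import Data.Nat as ℕ using (ℕ; zero; suc; _≤ᵇ_; _<ᵇ_; _≡ᵇ_; ∣_-_∣)
open import Data.Nat.Divisibility using (_∣?_)
open import Data.Integer as ℤ using (ℤ; 0ℤ; 1ℤ; _+_; _-_)
open import Data.List using (List; []; _∷_; map; _++_; take; drop; length; reverse; foldr; upTo)
open import Data.Bool.ListAction using (any)
open import Data.Product using (_×_; _,_)
open import Relation.Nullary using (does)

-- A word in the noncommuting variables X_0, X_1, X_2, ... is a list of indices.
-- (Indexing from 0 instead of 1 is immaterial: only the order of indices matters.)
Word : Set
Word = List ℕ

-- A formal power series with integer coefficients in the noncommuting variables
-- is determined by its coefficient function on words.
Series : Set
Series = Word → ℤ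

Σℤ : List ℤ → ℤ
Σℤ = foldr _+_ 0ℤ

splits : Word → List (Word × Word)
splits [] = ([] , []) ∷ []
splits (x ∷ w) = ([] , x ∷ w) ∷ map (λ { (u , v) → (x ∷ u , v) }) (splits w)

oneₛ : Series
oneₛ [] = 1ℤ
oneₛ (_ ∷ _) = 0ℤ

_+ₛ_ : Series → Series → Series
(f +ₛ g) w = f w + g w

_-ₛ_ : Series → Series → Series
(f -ₛ g) w = f w - g w

_*ₛ_ : Series → Series → Series
(f *ₛ g) w = Σℤ (map (λ { (u , v) → f u ℤ.* g v }) (splits w))

sumₛ : ℕ → (ℕ → Series) → Series
sumₛ m F w = Σℤ (map (λ k → F k w) (upTo m))

indicator : Bool → ℤ
indicator b = if b then 1ℤ else 0ℤ

weakInc : Word → Bool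
weakInc [] = true
weakInc (x ∷ []) = true
weakInc (x ∷ y ∷ w) = (x ≤ᵇ y) ∧ weakInc (y ∷ w)

h : ℕ → Series
h n w = indicator ((length w ≡ᵇ n) ∧ weakInc w)

-- Is there a strict descent between the last letter of u and the first letter of v?
-- (true when v is empty: no condition at the end of the word)
descentBetween : Word → Word → Bool
descentBetween u [] = true
descentBetween u (y ∷ _) with reverse u
... | [] = false
... | x ∷ _ = y <ᵇ x

ribbonShape : List ℕ → Word → Bool
ribbonShape [] [] = true
ribbonShape [] (_ ∷ _) = false
ribbonShape (l ∷ L) w =
  (length (take l w) ≡ᵇ l) ∧ weakInc (take l w)
    ∧ descentBetween (take l w) (drop l w) ∧ ribbonShape L (drop l w)

ribbon : List ℕ → Series
ribbon L w = indicator (ribbonShape L w)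

incHeads : List (List ℕ) → List (List ℕ)
incHeads [] = []
incHeads ([] ∷ Ls) = incHeads Ls
incHeads ((x ∷ L) ∷ Ls) = (suc x ∷ L) ∷ incHeads Ls

compositions : ℕ → List (List ℕ)
compositions zero = [] ∷ []
compositions (suc n) =
  map (1 ∷_) (compositions n) ++ incHeads (compositions n)

-- Sum of r_L over all compositions L satisfying a predicate P.  Since r_L has only
-- words of length |L| in its support, the coefficient of w only involves
-- compositions of length w.
sumRibbons : (List ℕ → Bool) → Series
sumRibbons P w = Σℤ (map (λ L → if P L then ribbon L w else 0ℤ) (compositions (length w)))

congMod : ℕ → ℕ → ℕ → Bool
congMod M a c = does (M ∣? ∣ a - c ∣)

allowedPart : ℕ → ℕ → ℕ → ℕ → Bool
allowedPart m b r p = any (λ j → congMod (m ℕ.* r ℕ.* b) p (j ℕ.* b)) (upTo r)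

allParts : (ℕ → Bool) → List ℕ → Bool
allParts P [] = true
allParts P (x ∷ L) = P x ∧ allParts P L

lhsSeries : ℕ → ℕ → ℕ → Series
lhsSeries m b r = sumₛ m (λ k → h (k ℕ.* r ℕ.* b) -ₛ h ((k ℕ.* r ℕ.+ 1) ℕ.* b))

rhsSeries : ℕ → ℕ → ℕ → Series
rhsSeries m b r = sumRibbons (allParts (allowedPart m b r))

module Submission where

-- The identity is an instance of a general inversion principle (module Inversion): if
-- 0 ∈ A ⊆ ℕ and the one-variable series Σ c(n)tⁿ and Σ_{n∈A} tⁿ are mutually inverse,
-- then Σₙ c(n)·hₙ and Σ_{L ⊆ A} r_L are mutually inverse.  Every word has exactly one
-- ribbon shape, its sequence of run lengths (sumRibbons-runs), so the coefficient of a word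
-- in Σ_{L ⊆ A} r_L is a product over its runs (runWeight).  In a factorisation u·v with u
-- (resp. v) weakly increasing, u is a prefix of the first run (resp. v a suffix of the last
-- run), so each coefficient of the product collapses to Σ_{j ≤ p} c(j)·[p − j ∈ A] for a
-- run length p ≥ 1, which vanishes.
--
-- For the theorem, c(t) = Σ_{k<m} (t^{krb} − t^{(kr+1)b}) and A = {n : n ≡ jb mod mrb, j < r}
-- (module Parameters); c(t)·A(t) = 1 because Σ_{k<m} t^{krb} · A(t) = Σ_{b ∣ ℓ} t^ℓ
-- (E-divisibility).

open import Defs
open import Data.Nat using (ℕ; _≤_)
open import Data.Product using (_×_)
open import Relation.Binary.PropositionalEquality using (_≡_)

open import Data.Bool using (Bool; true; false; not; _∧_; if_then_else_)
open import Data.Bool.Properties using (∧-identityʳ; ∧-comm; T-≡)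
open import Data.Bool.ListAction using (or)
open import Data.Empty using (⊥; ⊥-elim)
open import Data.Integer using (ℤ; 0ℤ; 1ℤ) renaming (_+_ to _+ℤ_; _-_ to _-ℤ_; _*_ to _*ℤ_)
import Data.Integer.Properties as ℤₚ
open import Data.Integer.Tactic.RingSolver using (solve-∀)
open import Data.List using (List; []; _∷_; _∷ʳ_; map; _++_; length; upTo; reverse; take; drop)
import Data.List.Properties as Listₚ
open import Data.List.Membership.Propositional using (lose; find)
open import Data.List.Membership.Propositional.Properties using (∈-upTo⁺; ∈-upTo⁻)
open import Data.List.Relation.Unary.All as All using (All; []; _∷_)
import Data.List.Relation.Unary.All.Properties as Allₚ
open import Data.List.Relation.Unary.Any.Properties using (any⁺; any⁻)
open import Data.Nat using (zero; suc; _+_; _*_; _∸_; _<_; _≤ᵇ_; _<ᵇ_; _≡ᵇ_; z≤n; s≤s; _≤?_; _<?_; ∣_-_∣; _⊔_)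
open import Data.Nat.Divisibility using (_∣_; _∣?_; divides; ∣-refl; ∣m+n∣m⇒∣n; ∣m∣n⇒∣m+n; _∣0; ∣⇒≤; n∣m*n)
open import Data.Nat.Induction using (<-rec)
import Data.Nat.Properties as ℕₚ
import Data.Nat.Tactic.RingSolver as ℕSolver
open import Data.Product using (_,_; proj₁; proj₂; ∃)
open import Data.Sum using (_⊎_; inj₁; inj₂)
open import Data.Unit using (⊤; tt)
open import Function using (_∘_)
open import Function.Bundles using (_⇔_; mk⇔; Equivalence)
open import Relation.Binary.PropositionalEquality using (refl; sym; trans; cong; cong₂; subst; module ≡-Reasoning)
open import Relation.Nullary using (Dec; yes; no; does; ¬_)
open import Relation.Nullary.Decidable using (dec-true; dec-false; does-⇔)

Σ≤ : ℕ → (ℕ → ℤ) → ℤ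
Σ≤ zero f = f 0
Σ≤ (suc n) f = f 0 +ℤ Σ≤ n (f ∘ suc)

Σ≤-cong : ∀ n {f g : ℕ → ℤ} → (∀ i → i ≤ n → f i ≡ g i) → Σ≤ n f ≡ Σ≤ n g
Σ≤-cong zero eq = eq 0 z≤n
Σ≤-cong (suc n) eq = cong₂ _+ℤ_ (eq 0 z≤n) (Σ≤-cong n (λ i i≤n → eq (suc i) (s≤s i≤n)))

Σ≤-snoc : ∀ n (f : ℕ → ℤ) → Σ≤ (suc n) f ≡ Σ≤ n f +ℤ f (suc n)
Σ≤-snoc zero f = refl
Σ≤-snoc (suc n) f = trans (cong (f 0 +ℤ_) (Σ≤-snoc n (f ∘ suc))) (sym (ℤₚ.+-assoc (f 0) _ _))

Σ≤-reverse : ∀ n (f : ℕ → ℤ) → Σ≤ n f ≡ Σ≤ n (λ i → f (n ∸ i))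
Σ≤-reverse zero f = refl
Σ≤-reverse (suc n) f = begin
    f 0 +ℤ Σ≤ n (f ∘ suc)
  ≡⟨ cong (f 0 +ℤ_) (Σ≤-reverse n (f ∘ suc)) ⟩
    f 0 +ℤ Σ≤ n (λ i → f (suc (n ∸ i)))
  ≡⟨ ℤₚ.+-comm (f 0) _ ⟩
    Σ≤ n (λ i → f (suc (n ∸ i))) +ℤ f 0
  ≡⟨ cong₂ _+ℤ_ (Σ≤-cong n (λ i i≤n → cong f (sym (ℕₚ.+-∸-assoc 1 i≤n))))
                (cong f (sym (ℕₚ.n∸n≡0 n))) ⟩
    Σ≤ n (λ i → f (suc n ∸ i)) +ℤ f (suc n ∸ suc n)
  ≡⟨ sym (Σ≤-snoc n (λ i → f (suc n ∸ i))) ⟩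
    Σ≤ (suc n) (λ i → f (suc n ∸ i)) ∎
  where open ≡-Reasoning

Σ≤-zero : ∀ n (f : ℕ → ℤ) → (∀ i → f i ≡ 0ℤ) → Σ≤ n f ≡ 0ℤ
Σ≤-zero zero f f≡0 = f≡0 0
Σ≤-zero (suc n) f f≡0 = cong₂ _+ℤ_ (f≡0 0) (Σ≤-zero n (f ∘ suc) (f≡0 ∘ suc))

Σ≤-+ : ∀ n (f g : ℕ → ℤ) → Σ≤ n (λ i → f i +ℤ g i) ≡ Σ≤ n f +ℤ Σ≤ n g
Σ≤-+ zero f g = refl
Σ≤-+ (suc n) f g =
  trans (cong (f 0 +ℤ g 0 +ℤ_) (Σ≤-+ n (f ∘ suc) (g ∘ suc))) (interchange (f 0) (g 0) _ _)
  where
  interchange : ∀ a b c d → (a +ℤ b) +ℤ (c +ℤ d) ≡ (a +ℤ c) +ℤ (b +ℤ d)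
  interchange = solve-∀

Σ≤-- : ∀ n (f g : ℕ → ℤ) → Σ≤ n (λ i → f i -ℤ g i) ≡ Σ≤ n f -ℤ Σ≤ n g
Σ≤-- zero f g = refl
Σ≤-- (suc n) f g =
  trans (cong (f 0 -ℤ g 0 +ℤ_) (Σ≤-- n (f ∘ suc) (g ∘ suc))) (interchange (f 0) (g 0) _ _)
  where
  interchange : ∀ a b c d → (a -ℤ b) +ℤ (c -ℤ d) ≡ (a +ℤ c) -ℤ (b +ℤ d)
  interchange = solve-∀

Σ≤-select : ∀ n t (h : ℕ → ℤ) →
  Σ≤ n (λ j → indicator (j ≡ᵇ t) *ℤ h j) ≡ (if does (t ≤? n) then h t else 0ℤ)
Σ≤-select zero zero h = ℤₚ.*-identityˡ (h 0)
Σ≤-select zero (suc t) h = ℤₚ.*-zeroˡ (h 0)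
Σ≤-select (suc n) zero h =
  trans (cong₂ _+ℤ_ (ℤₚ.*-identityˡ (h 0)) (Σ≤-zero n _ (λ i → ℤₚ.*-zeroˡ (h (suc i)))))
        (ℤₚ.+-identityʳ (h 0))
Σ≤-select (suc n) (suc t) h =
  trans (cong₂ _+ℤ_ (ℤₚ.*-zeroˡ (h 0)) (Σ≤-select n t (h ∘ suc)))
        (trans (ℤₚ.+-identityˡ _) (cong (λ b → if b then h (suc t) else 0ℤ) (does-suc t n)))
  where
  does-suc : ∀ t n → does (t ≤? n) ≡ does (suc t ≤? suc n)
  does-suc zero n = refl
  does-suc (suc t) n = refl

Σℤ-++ : ∀ (xs ys : List ℤ) → Σℤ (xs ++ ys) ≡ Σℤ xs +ℤ Σℤ ys
Σℤ-++ [] ys = sym (ℤₚ.+-identityˡ _)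
Σℤ-++ (x ∷ xs) ys = trans (cong (x +ℤ_) (Σℤ-++ xs ys)) (sym (ℤₚ.+-assoc x _ _))

module _ {A : Set} where

  Σ-cong : ∀ (xs : List A) {f g : A → ℤ} → (∀ x → f x ≡ g x) → Σℤ (map f xs) ≡ Σℤ (map g xs)
  Σ-cong xs f≗g = cong Σℤ (Listₚ.map-cong f≗g xs)

  Σ-zero : ∀ (xs : List A) (f : A → ℤ) → (∀ x → f x ≡ 0ℤ) → Σℤ (map f xs) ≡ 0ℤ
  Σ-zero [] f f≡0 = refl
  Σ-zero (x ∷ xs) f f≡0 = cong₂ _+ℤ_ (f≡0 x) (Σ-zero xs f f≡0)

  Σ-*ˡ : ∀ (xs : List A) (f : A → ℤ) a → a *ℤ Σℤ (map f xs) ≡ Σℤ (map (λ x → a *ℤ f x) xs)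
  Σ-*ˡ [] f a = ℤₚ.*-zeroʳ a
  Σ-*ˡ (x ∷ xs) f a = trans (ℤₚ.*-distribˡ-+ a (f x) _) (cong (a *ℤ f x +ℤ_) (Σ-*ˡ xs f a))

  Σ-- : ∀ (xs : List A) (f g : A → ℤ) →
    Σℤ (map (λ x → f x -ℤ g x) xs) ≡ Σℤ (map f xs) -ℤ Σℤ (map g xs)
  Σ-- [] f g = refl
  Σ-- (x ∷ xs) f g = trans (cong (f x -ℤ g x +ℤ_) (Σ-- xs f g)) (interchange (f x) (g x) _ _)
    where
    interchange : ∀ a b c d → (a -ℤ b) +ℤ (c -ℤ d) ≡ (a +ℤ c) -ℤ (b +ℤ d)
    interchange = solve-∀

  Σ-if : ∀ (D : Bool) (xs : List A) (f : A → ℤ) →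
    Σℤ (map (λ x → if D then f x else 0ℤ) xs) ≡ (if D then Σℤ (map f xs) else 0ℤ)
  Σ-if true xs f = refl
  Σ-if false xs f = Σ-zero xs _ (λ _ → refl)

Σ<-front : ∀ n (f : ℕ → ℤ) → Σℤ (map f (upTo (suc n))) ≡ f 0 +ℤ Σℤ (map (f ∘ suc) (upTo n))
Σ<-front n f = cong (f 0 +ℤ_) (cong Σℤ (trans (Listₚ.map-applyUpTo suc f n) (sym (Listₚ.map-upTo (f ∘ suc) n))))

Σ<-back : ∀ n (f : ℕ → ℤ) → Σℤ (map f (upTo (suc n))) ≡ Σℤ (map f (upTo n)) +ℤ f n
Σ<-back n f = begin
    Σℤ (map f (upTo (suc n)))
  ≡⟨ cong (Σℤ ∘ map f) (sym (Listₚ.upTo-∷ʳ n)) ⟩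
    Σℤ (map f (upTo n ++ n ∷ []))
  ≡⟨ cong Σℤ (Listₚ.map-++ f (upTo n) (n ∷ [])) ⟩
    Σℤ (map f (upTo n) ++ f n ∷ [])
  ≡⟨ Σℤ-++ (map f (upTo n)) (f n ∷ []) ⟩
    Σℤ (map f (upTo n)) +ℤ (f n +ℤ 0ℤ)
  ≡⟨ cong (Σℤ (map f (upTo n)) +ℤ_) (ℤₚ.+-identityʳ (f n)) ⟩
    Σℤ (map f (upTo n)) +ℤ f n ∎
  where open ≡-Reasoning

-- Cauchy product of coefficient sequences: the coefficient of tⁿ in F(t)·G(t).
conv : (ℕ → ℤ) → (ℕ → ℤ) → ℕ → ℤ
conv f g n = Σ≤ n (λ j → f j *ℤ g (n ∸ j))

conv-comm : ∀ f g n → conv f g n ≡ conv g f n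
conv-comm f g n = trans (Σ≤-reverse n _) (Σ≤-cong n term)
  where
  term : ∀ i → i ≤ n → f (n ∸ i) *ℤ g (n ∸ (n ∸ i)) ≡ g i *ℤ f (n ∸ i)
  term i i≤n = trans (ℤₚ.*-comm (f (n ∸ i)) _) (cong (λ k → g k *ℤ f (n ∸ i)) (ℕₚ.m∸[m∸n]≡n i≤n))

conv-+ : ∀ f f' g n → conv (λ j → f j +ℤ f' j) g n ≡ conv f g n +ℤ conv f' g n
conv-+ f f' g n =
  trans (Σ≤-cong n (λ j _ → ℤₚ.*-distribʳ-+ (g (n ∸ j)) (f j) (f' j))) (Σ≤-+ n _ _)

conv-- : ∀ f f' g n → conv (λ j → f j -ℤ f' j) g n ≡ conv f g n -ℤ conv f' g n
conv-- f f' g n =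
  trans (Σ≤-cong n (λ j _ → distrib (f j) (f' j) (g (n ∸ j)))) (Σ≤-- n _ _)
  where
  distrib : ∀ x y z → (x -ℤ y) *ℤ z ≡ x *ℤ z -ℤ y *ℤ z
  distrib = solve-∀

conv-Σ : ∀ {A : Set} (ks : List A) (F : A → ℕ → ℤ) g n →
  conv (λ j → Σℤ (map (λ k → F k j) ks)) g n ≡ Σℤ (map (λ k → conv (F k) g n) ks)
conv-Σ [] F g n = Σ≤-zero n _ (λ j → ℤₚ.*-zeroˡ (g (n ∸ j)))
conv-Σ (k ∷ ks) F g n =
  trans (conv-+ (F k) (λ j → Σℤ (map (λ k → F k j) ks)) g n) (cong (conv (F k) g n +ℤ_) (conv-Σ ks F g n))

-- The coefficient of tⁿ in t^s·G(t).
shifted : (ℕ → ℤ) → ℕ → ℕ → ℤ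
shifted g s n = if does (s ≤? n) then g (n ∸ s) else 0ℤ

shifted-yes : ∀ g {s n} → s ≤ n → shifted g s n ≡ g (n ∸ s)
shifted-yes g {s} {n} s≤n = cong (λ t → if t then g (n ∸ s) else 0ℤ) (dec-true (s ≤? n) s≤n)

shifted-no : ∀ g {s n} → ¬ (s ≤ n) → shifted g s n ≡ 0ℤ
shifted-no g {s} {n} s≰n = cong (λ t → if t then g (n ∸ s) else 0ℤ) (dec-false (s ≤? n) s≰n)

shifted-+ : ∀ g u s n → shifted g (u + s) (u + n) ≡ shifted g s n
shifted-+ g u s n with s ≤? n
... | yes s≤n = trans (shifted-yes g (ℕₚ.+-monoʳ-≤ u s≤n))
                      (trans (cong g (ℕₚ.[m+n]∸[m+o]≡n∸o u n s)) (sym (shifted-yes g s≤n)))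
... | no s≰n = trans (shifted-no g (s≰n ∘ ℕₚ.+-cancelˡ-≤ u s n)) (sym (shifted-no g s≰n))

conv-monomial : ∀ s g n → conv (λ j → indicator (j ≡ᵇ s)) g n ≡ shifted g s n
conv-monomial s g n = Σ≤-select n s (λ j → g (n ∸ j))

incHead : List ℕ → List ℕ
incHead [] = []
incHead (k ∷ L) = suc k ∷ L

runs : Word → List ℕ
runs [] = []
runs (x ∷ []) = 1 ∷ []
runs (x ∷ y ∷ w) = if x ≤ᵇ y then incHead (runs (y ∷ w)) else 1 ∷ runs (y ∷ w)

<ᵇ-flip : ∀ x y → (y <ᵇ x) ≡ not (x ≤ᵇ y)
<ᵇ-flip zero y = refl
<ᵇ-flip (suc x) zero = refl
<ᵇ-flip (suc x) (suc y) = trans (<ᵇ-flip x y) (cong not (sym (<ᵇ-suc x y)))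
  where
  <ᵇ-suc : ∀ a n → (a <ᵇ suc n) ≡ (a ≤ᵇ n)
  <ᵇ-suc zero n = refl
  <ᵇ-suc (suc a) n = refl

-- A case split on the comparison of two letters that leaves the goal untouched.
ascent-or-descent : ∀ x y → (x ≤ᵇ y) ≡ true ⊎ (x ≤ᵇ y) ≡ false
ascent-or-descent x y with x ≤ᵇ y
... | true = inj₁ refl
... | false = inj₂ refl

belowHead : List ℕ → ℕ → Bool
belowHead [] z = false
belowHead (x ∷ _) z = z <ᵇ x

descent-via-reverse : ∀ u z v → descentBetween u (z ∷ v) ≡ belowHead (reverse u) z
descent-via-reverse u z v with reverse u
... | [] = refl
... | x ∷ _ = refl

descent-drop-first : ∀ x y t d → descentBetween (x ∷ y ∷ t) d ≡ descentBetween (y ∷ t) d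
descent-drop-first x y t [] = refl
descent-drop-first x y t (z ∷ v) = begin
    descentBetween (x ∷ y ∷ t) (z ∷ v)
  ≡⟨ descent-via-reverse (x ∷ y ∷ t) z v ⟩
    belowHead (reverse (x ∷ y ∷ t)) z
  ≡⟨ cong (λ ys → belowHead ys z) (Listₚ.unfold-reverse x (y ∷ t)) ⟩
    belowHead (reverse (y ∷ t) ∷ʳ x) z
  ≡⟨ cong (λ ys → belowHead (ys ∷ʳ x) z) (Listₚ.unfold-reverse y t) ⟩
    belowHead ((reverse t ∷ʳ y) ∷ʳ x) z
  ≡⟨ snoc-irrelevant (reverse t) ⟩
    belowHead (reverse t ∷ʳ y) z
  ≡⟨ cong (λ ys → belowHead ys z) (sym (Listₚ.unfold-reverse y t)) ⟩
    belowHead (reverse (y ∷ t)) z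
  ≡⟨ sym (descent-via-reverse (y ∷ t) z v) ⟩
    descentBetween (y ∷ t) (z ∷ v) ∎
  where
  open ≡-Reasoning
  snoc-irrelevant : ∀ zs → belowHead ((zs ∷ʳ y) ∷ʳ x) z ≡ belowHead (zs ∷ʳ y) z
  snoc-irrelevant [] = refl
  snoc-irrelevant (_ ∷ _) = refl

ribbon-long-head : ∀ k L x y w →
  ribbonShape (suc (suc k) ∷ L) (x ∷ y ∷ w) ≡ (x ≤ᵇ y) ∧ ribbonShape (suc k ∷ L) (y ∷ w)
ribbon-long-head k L x y w
  rewrite descent-drop-first x y (take k w) (drop k w)
  with x ≤ᵇ y | length (take k w) ≡ᵇ k
... | true | _ = refl
... | false | true = refl
... | false | false = refl

PositiveHead : List ℕ → Set
PositiveHead (suc _ ∷ _) = ⊤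
PositiveHead _ = ⊥

compositions-positive : ∀ n → All PositiveHead (compositions (suc n))
compositions-positive n =
  Allₚ.++⁺ (Allₚ.map⁺ (All.universal (λ _ → tt) (compositions n))) (incHeads-positive (compositions n))
  where
  incHeads-positive : ∀ Ls → All PositiveHead (incHeads Ls)
  incHeads-positive [] = []
  incHeads-positive ([] ∷ Ls) = incHeads-positive Ls
  incHeads-positive ((_ ∷ _) ∷ Ls) = tt ∷ incHeads-positive Ls

atIncHead : (List ℕ → ℤ) → List ℕ → ℤ
atIncHead g [] = 0ℤ
atIncHead g (k ∷ L) = g (suc k ∷ L)

Σ-incHeads : ∀ (g : List ℕ → ℤ) Ls → Σℤ (map g (incHeads Ls)) ≡ Σℤ (map (atIncHead g) Ls)
Σ-incHeads g [] = refl
Σ-incHeads g ([] ∷ Ls) = trans (Σ-incHeads g Ls) (sym (ℤₚ.+-identityˡ _))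
Σ-incHeads g ((k ∷ L) ∷ Ls) = cong (g (suc k ∷ L) +ℤ_) (Σ-incHeads g Ls)

selectedRibbon : (List ℕ → Bool) → Word → List ℕ → ℤ
selectedRibbon Q w L = if Q L then ribbon L w else 0ℤ

select-∧ : ∀ q d e →
  (if q then indicator (d ∧ e) else 0ℤ) ≡ (if d then (if q then indicator e else 0ℤ) else 0ℤ)
select-∧ true true e = refl
select-∧ true false e = refl
select-∧ false true e = refl
select-∧ false false e = refl

-- Induction on w: the first two letters
-- either form a descent (first part 1) or extend the first run.
sumRibbons-runs : ∀ Q w → sumRibbons Q w ≡ indicator (Q (runs w))
sumRibbons-runs Q [] = ℤₚ.+-identityʳ _
sumRibbons-runs Q (x ∷ []) = ℤₚ.+-identityʳ _
sumRibbons-runs Q (x ∷ y ∷ w) = begin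
    Σℤ (map g (map (1 ∷_) C ++ incHeads C))
  ≡⟨ cong Σℤ (Listₚ.map-++ g (map (1 ∷_) C) (incHeads C)) ⟩
    Σℤ (map g (map (1 ∷_) C) ++ map g (incHeads C))
  ≡⟨ Σℤ-++ (map g (map (1 ∷_) C)) _ ⟩
    Σℤ (map g (map (1 ∷_) C)) +ℤ Σℤ (map g (incHeads C))
  ≡⟨ cong₂ _+ℤ_ (cong Σℤ (sym (Listₚ.map-∘ C))) (Σ-incHeads g C) ⟩
    Σℤ (map (g ∘ (1 ∷_)) C) +ℤ Σℤ (map (atIncHead g) C)
  ≡⟨ cong₂ _+ℤ_ (Σ-cong C descentFirst)
                (cong Σℤ (Listₚ.map-cong-local (All.map (λ {L} → ascentFirst L) (compositions-positive (length w))))) ⟩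
    Σℤ (map (λ L → if y <ᵇ x then term (Q ∘ (1 ∷_)) L else 0ℤ) C)
      +ℤ Σℤ (map (λ L → if x ≤ᵇ y then term (Q ∘ incHead) L else 0ℤ) C)
  ≡⟨ cong₂ _+ℤ_ (Σ-if (y <ᵇ x) C _) (Σ-if (x ≤ᵇ y) C _) ⟩
    (if y <ᵇ x then sumRibbons (Q ∘ (1 ∷_)) (y ∷ w) else 0ℤ)
      +ℤ (if x ≤ᵇ y then sumRibbons (Q ∘ incHead) (y ∷ w) else 0ℤ)
  ≡⟨ cong₂ _+ℤ_ (cong (λ s → if y <ᵇ x then s else 0ℤ) (sumRibbons-runs (Q ∘ (1 ∷_)) (y ∷ w)))
                (cong (λ s → if x ≤ᵇ y then s else 0ℤ) (sumRibbons-runs (Q ∘ incHead) (y ∷ w))) ⟩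
    (if y <ᵇ x then indicator (Q (1 ∷ runs (y ∷ w))) else 0ℤ)
      +ℤ (if x ≤ᵇ y then indicator (Q (incHead (runs (y ∷ w)))) else 0ℤ)
  ≡⟨ exclusive ⟩
    indicator (Q (runs (x ∷ y ∷ w))) ∎
  where
  open ≡-Reasoning
  C : List (List ℕ)
  C = compositions (suc (length w))
  g : List ℕ → ℤ
  g = selectedRibbon Q (x ∷ y ∷ w)
  term : (List ℕ → Bool) → List ℕ → ℤ
  term P = selectedRibbon P (y ∷ w)
  descentFirst : ∀ L → g (1 ∷ L) ≡ (if y <ᵇ x then term (Q ∘ (1 ∷_)) L else 0ℤ)
  descentFirst L = select-∧ (Q (1 ∷ L)) (y <ᵇ x) (ribbonShape L (y ∷ w))
  ascentFirst : ∀ L → PositiveHead L → atIncHead g L ≡ (if x ≤ᵇ y then term (Q ∘ incHead) L else 0ℤ)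
  ascentFirst (suc k ∷ L) _ =
    trans (cong (λ s → if Q (suc (suc k) ∷ L) then indicator s else 0ℤ) (ribbon-long-head k L x y w))
          (select-∧ (Q (suc (suc k) ∷ L)) (x ≤ᵇ y) (ribbonShape (suc k ∷ L) (y ∷ w)))
  exclusive : (if y <ᵇ x then indicator (Q (1 ∷ runs (y ∷ w))) else 0ℤ)
                +ℤ (if x ≤ᵇ y then indicator (Q (incHead (runs (y ∷ w)))) else 0ℤ)
              ≡ indicator (Q (runs (x ∷ y ∷ w)))
  exclusive rewrite <ᵇ-flip x y with x ≤ᵇ y
  ... | true = ℤₚ.+-identityˡ _
  ... | false = ℤₚ.+-identityʳ _

Σ-splits-cons : ∀ (F : Word × Word → ℤ) x w →
  Σℤ (map F (splits (x ∷ w))) ≡ F ([] , x ∷ w) +ℤ Σℤ (map (λ p → F (x ∷ proj₁ p , proj₂ p)) (splits w))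
Σ-splits-cons F x w = cong (F ([] , x ∷ w) +ℤ_) (cong Σℤ (sym (Listₚ.map-∘ (splits w))))

*ₛ-cons : ∀ (f g : Series) x w →
  (f *ₛ g) (x ∷ w) ≡ f [] *ℤ g (x ∷ w) +ℤ Σℤ (map (λ p → f (x ∷ proj₁ p) *ℤ g (proj₂ p)) (splits w))
*ₛ-cons f g = Σ-splits-cons (λ p → f (proj₁ p) *ℤ g (proj₂ p))

*ₛ-congˡ : ∀ {f f' : Series} (g : Series) → (∀ u → f u ≡ f' u) → ∀ w → (f *ₛ g) w ≡ (f' *ₛ g) w
*ₛ-congˡ g f≗f' w = Σ-cong (splits w) (λ p → cong (_*ℤ g (proj₂ p)) (f≗f' (proj₁ p)))

*ₛ-congʳ : ∀ (f : Series) {g g' : Series} → (∀ v → g v ≡ g' v) → ∀ w → (f *ₛ g) w ≡ (f *ₛ g') w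
*ₛ-congʳ f g≗g' w = Σ-cong (splits w) (λ p → cong (f (proj₁ p) *ℤ_) (g≗g' (proj₂ p)))

indicator-∧ : ∀ p q → indicator (p ∧ q) ≡ indicator p *ℤ indicator q
indicator-∧ true q = sym (ℤₚ.*-identityˡ _)
indicator-∧ false q = refl

-- The series Σₙ c(n)·hₙ: the coefficient of w is c(|w|) when w is weakly increasing.
hSum : (ℕ → ℤ) → Series
hSum c w = if weakInc w then c (length w) else 0ℤ

module Inversion (A : ℕ → Bool) (A0 : A 0 ≡ true) where

  a : ℕ → ℤ
  a = indicator ∘ A

  a0 : a 0 ≡ 1ℤ
  a0 = cong indicator A0

  R : Series
  R = sumRibbons (allParts A)

  -- runWeight f x w = f(p₁)·a(p₂)·a(p₃)⋯ where p₁, p₂, … are the run lengths of x ∷ w.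
  runWeight : (ℕ → ℤ) → ℕ → Word → ℤ
  runWeight f x [] = f 1
  runWeight f x (y ∷ w) = if x ≤ᵇ y then runWeight (f ∘ suc) y w else f 1 *ℤ runWeight a y w

  firstThen : (ℕ → Bool) → List ℕ → Bool
  firstThen B [] = true
  firstThen B (p ∷ L) = B p ∧ allParts A L

  allParts-firstThen : ∀ L → allParts A L ≡ firstThen A L
  allParts-firstThen [] = refl
  allParts-firstThen (_ ∷ _) = refl

  firstThen-runs : ∀ B x w → indicator (firstThen B (runs (x ∷ w))) ≡ runWeight (indicator ∘ B) x w
  firstThen-runs B x [] = cong indicator (∧-identityʳ (B 1))
  firstThen-runs B x (y ∷ w) with x ≤ᵇ y
  ... | true = trans (cong indicator (incHead-shift (runs (y ∷ w)))) (firstThen-runs (B ∘ suc) y w)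
    where
    incHead-shift : ∀ L → firstThen B (incHead L) ≡ firstThen (B ∘ suc) L
    incHead-shift [] = refl
    incHead-shift (_ ∷ _) = refl
  ... | false =
    trans (indicator-∧ (B 1) _)
          (cong (indicator (B 1) *ℤ_)
                (trans (cong indicator (allParts-firstThen (runs (y ∷ w)))) (firstThen-runs A y w)))

  R-nil : R [] ≡ 1ℤ
  R-nil = sumRibbons-runs (allParts A) []

  R-cons : ∀ x w → R (x ∷ w) ≡ runWeight a x w
  R-cons x w = trans (sumRibbons-runs (allParts A) (x ∷ w))
                     (trans (cong indicator (allParts-firstThen (runs (x ∷ w)))) (firstThen-runs A x w))

  runWeight-linear : ∀ k f g x w →
    runWeight (λ n → k *ℤ f n +ℤ g n) x w ≡ k *ℤ runWeight f x w +ℤ runWeight g x w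
  runWeight-linear k f g x [] = refl
  runWeight-linear k f g x (y ∷ w) with x ≤ᵇ y
  ... | true = runWeight-linear k (f ∘ suc) (g ∘ suc) y w
  ... | false = distrib k (f 1) (g 1) (runWeight a y w)
    where
    distrib : ∀ k s t ρ → (k *ℤ s +ℤ t) *ℤ ρ ≡ k *ℤ (s *ℤ ρ) +ℤ t *ℤ ρ
    distrib = solve-∀

  -- runWeight f only sees f at positive arguments (run lengths).
  runWeight-vanishing : ∀ f → (∀ n → f (suc n) ≡ 0ℤ) → ∀ x w → runWeight f x w ≡ 0ℤ
  runWeight-vanishing f f≡0 x [] = f≡0 0
  runWeight-vanishing f f≡0 x (y ∷ w) with x ≤ᵇ y
  ... | true = runWeight-vanishing (f ∘ suc) (f≡0 ∘ suc) y w
  ... | false = trans (cong (_*ℤ runWeight a y w) (f≡0 0)) (ℤₚ.*-zeroˡ (runWeight a y w))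

  hSum-ascent : ∀ c x y → (x ≤ᵇ y) ≡ true → ∀ u → hSum c (x ∷ y ∷ u) ≡ hSum (c ∘ suc) (y ∷ u)
  hSum-ascent c x y x≤y u rewrite x≤y = refl

  hSum-descent : ∀ c x y → (x ≤ᵇ y) ≡ false → ∀ u → hSum c (x ∷ y ∷ u) ≡ 0ℤ
  hSum-descent c x y x≰y u rewrite x≰y = refl

  runWeight-ascent : ∀ f x y → (x ≤ᵇ y) ≡ true → ∀ w → runWeight f x (y ∷ w) ≡ runWeight (f ∘ suc) y w
  runWeight-ascent f x y x≤y w rewrite x≤y = refl

  runWeight-descent : ∀ f x y → (x ≤ᵇ y) ≡ false → ∀ w → runWeight f x (y ∷ w) ≡ f 1 *ℤ runWeight a y w
  runWeight-descent f x y x≰y w rewrite x≰y = refl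

  hSum-times-R-expand : ∀ c x y w →
    (hSum c *ₛ R) (x ∷ y ∷ w)
      ≡ c 0 *ℤ R (x ∷ y ∷ w)
        +ℤ (c 1 *ℤ R (y ∷ w) +ℤ Σℤ (map (λ p → hSum c (x ∷ y ∷ proj₁ p) *ℤ R (proj₂ p)) (splits w)))
  hSum-times-R-expand c x y w =
    trans (*ₛ-cons (hSum c) R x (y ∷ w))
          (cong (c 0 *ℤ R (x ∷ y ∷ w) +ℤ_) (Σ-splits-cons (λ p → hSum c (x ∷ proj₁ p) *ℤ R (proj₂ p)) y w))

  -- Left product, computed run by run: only prefixes of the first run contribute
  -- from hSum c, so the first run length p gets weight Σ_{j ≤ p} c(j)·a(p − j).
  hSum-times-R : ∀ c x w → (hSum c *ₛ R) (x ∷ w) ≡ runWeight (conv c a) x w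
  hSum-times-R c x [] =
    trans (cong₂ (λ s t → c 0 *ℤ s +ℤ (c 1 *ℤ t +ℤ 0ℤ)) (R-cons x []) (trans R-nil (sym a0)))
          (cong (c 0 *ℤ a 1 +ℤ_) (ℤₚ.+-identityʳ (c 1 *ℤ a 0)))
  hSum-times-R c x (y ∷ w) with ascent-or-descent x y
  ... | inj₁ order = begin
      (hSum c *ₛ R) (x ∷ y ∷ w)
    ≡⟨ hSum-times-R-expand c x y w ⟩
      c 0 *ℤ R (x ∷ y ∷ w)
        +ℤ (c 1 *ℤ R (y ∷ w) +ℤ Σℤ (map (λ p → hSum c (x ∷ y ∷ proj₁ p) *ℤ R (proj₂ p)) (splits w)))
    ≡⟨ cong₂ _+ℤ_ (cong (c 0 *ℤ_) (trans (R-cons x (y ∷ w)) (runWeight-ascent a x y order w)))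
                  (cong (c 1 *ℤ R (y ∷ w) +ℤ_)
                        (Σ-cong (splits w) (λ p → cong (_*ℤ R (proj₂ p)) (hSum-ascent c x y order (proj₁ p))))) ⟩
      c 0 *ℤ runWeight (a ∘ suc) y w
        +ℤ (c 1 *ℤ R (y ∷ w) +ℤ Σℤ (map (λ p → hSum (c ∘ suc) (y ∷ proj₁ p) *ℤ R (proj₂ p)) (splits w)))
    ≡⟨ cong (c 0 *ℤ runWeight (a ∘ suc) y w +ℤ_) (sym (*ₛ-cons (hSum (c ∘ suc)) R y w)) ⟩
      c 0 *ℤ runWeight (a ∘ suc) y w +ℤ (hSum (c ∘ suc) *ₛ R) (y ∷ w)
    ≡⟨ cong (c 0 *ℤ runWeight (a ∘ suc) y w +ℤ_) (hSum-times-R (c ∘ suc) y w) ⟩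
      c 0 *ℤ runWeight (a ∘ suc) y w +ℤ runWeight (conv (c ∘ suc) a) y w
    ≡⟨ sym (runWeight-linear (c 0) (a ∘ suc) (conv (c ∘ suc) a) y w) ⟩
      runWeight (conv c a ∘ suc) y w
    ≡⟨ sym (runWeight-ascent (conv c a) x y order w) ⟩
      runWeight (conv c a) x (y ∷ w) ∎
    where open ≡-Reasoning
  ... | inj₂ order = begin
      (hSum c *ₛ R) (x ∷ y ∷ w)
    ≡⟨ hSum-times-R-expand c x y w ⟩
      c 0 *ℤ R (x ∷ y ∷ w)
        +ℤ (c 1 *ℤ R (y ∷ w) +ℤ Σℤ (map (λ p → hSum c (x ∷ y ∷ proj₁ p) *ℤ R (proj₂ p)) (splits w)))
    ≡⟨ cong₂ _+ℤ_ (cong (c 0 *ℤ_) (trans (R-cons x (y ∷ w)) (runWeight-descent a x y order w)))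
                  (cong₂ _+ℤ_ (cong (c 1 *ℤ_) (R-cons y w))
                              (Σ-zero (splits w) _ (λ p →
                                 trans (cong (_*ℤ R (proj₂ p)) (hSum-descent c x y order (proj₁ p)))
                                       (ℤₚ.*-zeroˡ (R (proj₂ p)))))) ⟩
      c 0 *ℤ (a 1 *ℤ ρ) +ℤ (c 1 *ℤ ρ +ℤ 0ℤ)
    ≡⟨ factor (c 0) (a 1) (c 1) ρ ⟩
      (c 0 *ℤ a 1 +ℤ c 1 *ℤ 1ℤ) *ℤ ρ
    ≡⟨ cong (λ t → (c 0 *ℤ a 1 +ℤ c 1 *ℤ t) *ℤ ρ) (sym a0) ⟩
      conv c a 1 *ℤ ρ
    ≡⟨ sym (runWeight-descent (conv c a) x y order w) ⟩
      runWeight (conv c a) x (y ∷ w) ∎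
    where
    open ≡-Reasoning
    ρ : ℤ
    ρ = runWeight a y w
    factor : ∀ s t u ρ → s *ℤ (t *ℤ ρ) +ℤ (u *ℤ ρ +ℤ 0ℤ) ≡ (s *ℤ t +ℤ u *ℤ 1ℤ) *ℤ ρ
    factor = solve-∀

  module _ (c : ℕ → ℤ) (c0 : c 0 ≡ 1ℤ) (inverse : ∀ n → conv c a (suc n) ≡ 0ℤ) where

    suffixSum : (ℕ → ℤ) → ℕ → Word → ℤ
    suffixSum f x w = Σℤ (map (λ p → runWeight f x (proj₁ p) *ℤ hSum c (proj₂ p)) (splits w))

    -- Only suffixes of the last run contribute from hSum c.
    suffixSum-closed : ∀ f x w →
      suffixSum f x w ≡ (if weakInc (x ∷ w) then conv (f ∘ suc) c (length w) else 0ℤ)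
    R-times-hSum-cons : ∀ x w → hSum c (x ∷ w) +ℤ suffixSum a x w ≡ 0ℤ

    suffixSum-closed f x [] = ℤₚ.+-identityʳ _
    suffixSum-closed f x (y ∷ w) with ascent-or-descent x y
    ... | inj₁ order = begin
        suffixSum f x (y ∷ w)
      ≡⟨ Σ-splits-cons (λ p → runWeight f x (proj₁ p) *ℤ hSum c (proj₂ p)) y w ⟩
        f 1 *ℤ hSum c (y ∷ w) +ℤ Σℤ (map (λ p → runWeight f x (y ∷ proj₁ p) *ℤ hSum c (proj₂ p)) (splits w))
      ≡⟨ cong (f 1 *ℤ hSum c (y ∷ w) +ℤ_) (Σ-cong (splits w) (λ p →
           cong (_*ℤ hSum c (proj₂ p)) (runWeight-ascent f x y order (proj₁ p)))) ⟩
        f 1 *ℤ hSum c (y ∷ w) +ℤ suffixSum (f ∘ suc) y w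
      ≡⟨ cong (f 1 *ℤ hSum c (y ∷ w) +ℤ_) (suffixSum-closed (f ∘ suc) y w) ⟩
        f 1 *ℤ hSum c (y ∷ w) +ℤ (if weakInc (y ∷ w) then conv (f ∘ suc ∘ suc) c (length w) else 0ℤ)
      ≡⟨ extend-run (weakInc (y ∷ w)) ⟩
        (if weakInc (y ∷ w) then conv (f ∘ suc) c (suc (length w)) else 0ℤ)
      ≡⟨ cong (λ b → if b ∧ weakInc (y ∷ w) then conv (f ∘ suc) c (suc (length w)) else 0ℤ) (sym order) ⟩
        (if weakInc (x ∷ y ∷ w) then conv (f ∘ suc) c (suc (length w)) else 0ℤ) ∎
      where
      open ≡-Reasoning
      extend-run : ∀ W → f 1 *ℤ (if W then c (suc (length w)) else 0ℤ)
                           +ℤ (if W then conv (f ∘ suc ∘ suc) c (length w) else 0ℤ)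
                         ≡ (if W then conv (f ∘ suc) c (suc (length w)) else 0ℤ)
      extend-run true = refl
      extend-run false = trans (ℤₚ.+-identityʳ _) (ℤₚ.*-zeroʳ (f 1))
    ... | inj₂ order = begin
        suffixSum f x (y ∷ w)
      ≡⟨ Σ-splits-cons (λ p → runWeight f x (proj₁ p) *ℤ hSum c (proj₂ p)) y w ⟩
        f 1 *ℤ hSum c (y ∷ w) +ℤ Σℤ (map (λ p → runWeight f x (y ∷ proj₁ p) *ℤ hSum c (proj₂ p)) (splits w))
      ≡⟨ cong (f 1 *ℤ hSum c (y ∷ w) +ℤ_) (Σ-cong (splits w) (λ p →
           trans (cong (_*ℤ hSum c (proj₂ p)) (runWeight-descent f x y order (proj₁ p))) (ℤₚ.*-assoc (f 1) _ _))) ⟩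
        f 1 *ℤ hSum c (y ∷ w) +ℤ Σℤ (map (λ p → f 1 *ℤ (runWeight a y (proj₁ p) *ℤ hSum c (proj₂ p))) (splits w))
      ≡⟨ cong (f 1 *ℤ hSum c (y ∷ w) +ℤ_) (sym (Σ-*ˡ (splits w) _ (f 1))) ⟩
        f 1 *ℤ hSum c (y ∷ w) +ℤ f 1 *ℤ suffixSum a y w
      ≡⟨ sym (ℤₚ.*-distribˡ-+ (f 1) _ _) ⟩
        f 1 *ℤ (hSum c (y ∷ w) +ℤ suffixSum a y w)
      ≡⟨ cong (f 1 *ℤ_) (R-times-hSum-cons y w) ⟩
        f 1 *ℤ 0ℤ
      ≡⟨ ℤₚ.*-zeroʳ (f 1) ⟩
        0ℤ
      ≡⟨ cong (λ b → if b ∧ weakInc (y ∷ w) then conv (f ∘ suc) c (suc (length w)) else 0ℤ) (sym order) ⟩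
        (if weakInc (x ∷ y ∷ w) then conv (f ∘ suc) c (suc (length w)) else 0ℤ) ∎
      where open ≡-Reasoning

    R-times-hSum-cons x w =
      trans (cong (hSum c (x ∷ w) +ℤ_) (suffixSum-closed a x w)) (last-run (weakInc (x ∷ w)))
      where
      last-run : ∀ W → (if W then c (suc (length w)) else 0ℤ)
                         +ℤ (if W then conv (a ∘ suc) c (length w) else 0ℤ) ≡ 0ℤ
      last-run true = begin
          c (suc (length w)) +ℤ conv (a ∘ suc) c (length w)
        ≡⟨ cong (_+ℤ conv (a ∘ suc) c (length w))
                (sym (trans (cong (_*ℤ c (suc (length w))) a0) (ℤₚ.*-identityˡ _))) ⟩
          conv a c (suc (length w))
        ≡⟨ conv-comm a c (suc (length w)) ⟩
          conv c a (suc (length w))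
        ≡⟨ inverse (length w) ⟩
          0ℤ ∎
        where open ≡-Reasoning
      last-run false = refl

    hSum-inverse : (∀ w → (hSum c *ₛ R) w ≡ oneₛ w) × (∀ w → (R *ₛ hSum c) w ≡ oneₛ w)
    hSum-inverse = left , right
      where
      left : ∀ w → (hSum c *ₛ R) w ≡ oneₛ w
      left [] = cong₂ (λ s t → s *ℤ t +ℤ 0ℤ) c0 R-nil
      left (x ∷ w) = trans (hSum-times-R c x w) (runWeight-vanishing (conv c a) inverse x w)
      right : ∀ w → (R *ₛ hSum c) w ≡ oneₛ w
      right [] = cong₂ (λ s t → s *ℤ t +ℤ 0ℤ) R-nil c0
      right (x ∷ w) = begin
          (R *ₛ hSum c) (x ∷ w)
        ≡⟨ *ₛ-cons R (hSum c) x w ⟩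
          R [] *ℤ hSum c (x ∷ w) +ℤ Σℤ (map (λ p → R (x ∷ proj₁ p) *ℤ hSum c (proj₂ p)) (splits w))
        ≡⟨ cong₂ _+ℤ_ (trans (cong (_*ℤ hSum c (x ∷ w)) R-nil) (ℤₚ.*-identityˡ _))
                      (Σ-cong (splits w) (λ p → cong (_*ℤ hSum c (proj₂ p)) (R-cons x (proj₁ p)))) ⟩
          hSum c (x ∷ w) +ℤ suffixSum a x w
        ≡⟨ R-times-hSum-cons x w ⟩
          0ℤ ∎
        where open ≡-Reasoning

lhsCoeff : ℕ → ℕ → ℕ → ℕ → ℤ
lhsCoeff m b r n = Σℤ (map (λ k → indicator (n ≡ᵇ k * r * b) -ℤ indicator (n ≡ᵇ (k * r + 1) * b)) (upTo m))

lhsSeries-hSum : ∀ m b r u → lhsSeries m b r u ≡ hSum (lhsCoeff m b r) u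
lhsSeries-hSum m b r u =
  trans (Σ-cong (upTo m) (λ k → select-sub (weakInc u) (length u ≡ᵇ k * r * b) (length u ≡ᵇ (k * r + 1) * b)))
        (Σ-if (weakInc u) (upTo m) _)
  where
  select-sub : ∀ W p q → indicator (p ∧ W) -ℤ indicator (q ∧ W)
                         ≡ (if W then indicator p -ℤ indicator q else 0ℤ)
  select-sub W p q rewrite ∧-comm p W | ∧-comm q W with W
  ... | true = refl
  ... | false = refl

does-true : ∀ {P : Set} (d : Dec P) → does d ≡ true → P
does-true (yes p) _ = p

∣-reflect : ∀ d e → d ∣ ∣ d - e ∣ ⇔ d ∣ e
∣-reflect d e with ℕₚ.≤-total e d
... | inj₁ e≤d with ℕₚ.m≤n⇒∃[o]m+o≡n e≤d
...   | f , refl rewrite ℕₚ.∣-∣-comm (e + f) e | ℕₚ.∣m-m+n∣≡n e f =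
        mk⇔ (complement (ℕₚ.+-comm f e)) (complement refl)
  where
  complement : ∀ {s t} → s + t ≡ e + f → e + f ∣ s → e + f ∣ t
  complement {s} {t} s+t≡d d∣s = ∣m+n∣m⇒∣n {m = s} {n = t} (subst (e + f ∣_) (sym s+t≡d) ∣-refl) d∣s
∣-reflect d e | inj₂ d≤e with ℕₚ.m≤n⇒∃[o]m+o≡n d≤e
...   | f , refl rewrite ℕₚ.∣m-m+n∣≡n d f =
        mk⇔ (∣m∣n⇒∣m+n ∣-refl) (λ d∣d+f → ∣m+n∣m⇒∣n d∣d+f ∣-refl)

∣-shift : ∀ d x y → d ∣ ∣ x + d - y ∣ ⇔ d ∣ ∣ x - y ∣
∣-shift d x y with ℕₚ.≤-total y x
... | inj₁ y≤x with ℕₚ.m≤n⇒∃[o]m+o≡n y≤x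
...   | e , refl
  rewrite ℕₚ.+-assoc y e d | ℕₚ.∣-∣-comm (y + (e + d)) y | ℕₚ.∣m-m+n∣≡n y (e + d)
        | ℕₚ.∣-∣-comm (y + e) y | ℕₚ.∣m-m+n∣≡n y e =
  mk⇔ (λ d∣e+d → ∣m+n∣m⇒∣n (subst (d ∣_) (ℕₚ.+-comm e d) d∣e+d) ∣-refl)
      (λ d∣e → ∣m∣n⇒∣m+n d∣e ∣-refl)
∣-shift d x y | inj₂ x≤y with ℕₚ.m≤n⇒∃[o]m+o≡n x≤y
...   | e , refl rewrite ℕₚ.∣m+n-m+o∣≡∣n-o∣ x d e | ℕₚ.∣m-m+n∣≡n x e = ∣-reflect d e

module Parameters (m' b' r' : ℕ) where

  m b r M rb : ℕ
  m = suc m'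
  b = suc b'
  r = suc r'
  M = m * r * b
  rb = r * b

  A : ℕ → Bool
  A = allowedPart m b r

  a : ℕ → ℤ
  a = indicator ∘ A

  c : ℕ → ℤ
  c = lhsCoeff m b r

  M≡rb+m'rb : M ≡ rb + m' * r * b
  M≡rb+m'rb = ℕₚ.*-distribʳ-+ b r (m' * r)

  rb≤M : rb ≤ M
  rb≤M = subst (rb ≤_) (sym M≡rb+m'rb) (ℕₚ.m≤m+n rb _)

  allowed-intro : ∀ p j → j < r → M ∣ ∣ p - j * b ∣ → A p ≡ true
  allowed-intro p j j<r M∣ =
    Equivalence.to T-≡ (any⁺ _ (lose (∈-upTo⁺ j<r) (Equivalence.from T-≡ (dec-true (M ∣? _) M∣))))

  allowed-elim : ∀ p → A p ≡ true → ∃ λ j → j < r × M ∣ ∣ p - j * b ∣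
  allowed-elim p allowed with find (any⁻ _ (upTo r) (Equivalence.from T-≡ allowed))
  ... | j , j∈ , M∣ = j , ∈-upTo⁻ j∈ , does-true (M ∣? _) (Equivalence.to T-≡ M∣)

  allowed-periodic : ∀ p → A (p + M) ≡ A p
  allowed-periodic p =
    cong or (Listₚ.map-cong (λ j → does-⇔ (∣-shift M p (j * b)) (M ∣? _) (M ∣? _)) (upTo r))

  allowed-multiple : ∀ j → j < r → A (j * b) ≡ true
  allowed-multiple j j<r = allowed-intro (j * b) j j<r (subst (M ∣_) (sym (ℕₚ.∣n-n∣≡0 (j * b))) (M ∣0))

  allowed-zero : A 0 ≡ true
  allowed-zero = allowed-multiple 0 (s≤s z≤n)

  allowed-below-M : ∀ p → p < M → A p ≡ true → ∃ λ j → j < r × p ≡ j * b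
  allowed-below-M p p<M allowed with allowed-elim p allowed
  ... | j , j<r , M∣ with ∣ p - j * b ∣ in dist
  ...   | zero = j , j<r , ℕₚ.∣m-n∣≡0⇒m≡n dist
  ...   | suc k = ⊥-elim (ℕₚ.<⇒≱ dist<M (∣⇒≤ M∣))
    where
    dist<M : suc k < M
    dist<M = ℕₚ.≤-<-trans (subst (_≤ p ⊔ j * b) dist (ℕₚ.∣m-n∣≤m⊔n p (j * b)))
                          (ℕₚ.⊔-lub p<M (ℕₚ.<-≤-trans (ℕₚ.*-monoˡ-< b j<r) rb≤M))

  allowed-below-rb : ∀ ℓ → ℓ < rb → A ℓ ≡ does (b ∣? ℓ)
  allowed-below-rb ℓ ℓ<rb with A ℓ in allowed
  ... | true with allowed-below-M ℓ (ℕₚ.<-≤-trans ℓ<rb rb≤M) allowed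
  ...   | j , _ , refl = sym (dec-true (b ∣? j * b) (n∣m*n j))
  allowed-below-rb ℓ ℓ<rb | false = sym (dec-false (b ∣? ℓ) not-multiple)
    where
    not-multiple : ¬ (b ∣ ℓ)
    not-multiple (divides q refl) with () ← trans (sym allowed) (allowed-multiple q (ℕₚ.*-cancelʳ-< b q r ℓ<rb))

  -- a(rb + ℓ) as the coefficient of t^ℓ in t^{(m−1)rb}·Σ_{n∈A} tⁿ: the parts in [rb, M) are
  -- not allowed, and from M on A repeats.
  allowed-after-rb : ∀ ℓ → a (rb + ℓ) ≡ shifted a (m' * r * b) ℓ
  allowed-after-rb ℓ with m' * r * b ≤? ℓ
  ... | yes m'rb≤ℓ =
    trans (cong indicator (trans (cong A rb+ℓ≡) (allowed-periodic (ℓ ∸ m' * r * b)))) (sym (shifted-yes a m'rb≤ℓ))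
    where
    rb+ℓ≡ : rb + ℓ ≡ (ℓ ∸ m' * r * b) + M
    rb+ℓ≡ = begin
        rb + ℓ
      ≡⟨ cong (rb +_) (sym (ℕₚ.m∸n+n≡m m'rb≤ℓ)) ⟩
        rb + ((ℓ ∸ m' * r * b) + m' * r * b)
      ≡⟨ left-comm rb (ℓ ∸ m' * r * b) (m' * r * b) ⟩
        (ℓ ∸ m' * r * b) + (rb + m' * r * b)
      ≡⟨ cong ((ℓ ∸ m' * r * b) +_) (sym M≡rb+m'rb) ⟩
        (ℓ ∸ m' * r * b) + M ∎
      where
      open ≡-Reasoning
      left-comm : ∀ x y z → x + (y + z) ≡ y + (x + z)
      left-comm = ℕSolver.solve-∀
  ... | no m'rb≰ℓ = trans (cong indicator not-allowed) (sym (shifted-no a m'rb≰ℓ))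
    where
    not-allowed : A (rb + ℓ) ≡ false
    not-allowed with A (rb + ℓ) in allowed
    ... | false = refl
    ... | true with allowed-below-M (rb + ℓ) rb+ℓ<M allowed
      where
      rb+ℓ<M : rb + ℓ < M
      rb+ℓ<M = subst (rb + ℓ <_) (sym M≡rb+m'rb) (ℕₚ.+-monoʳ-< rb (ℕₚ.≰⇒> m'rb≰ℓ))
    ...   | j , j<r , rb+ℓ≡jb =
      ⊥-elim (ℕₚ.<⇒≱ (ℕₚ.*-monoˡ-< b j<r) (subst (rb ≤_) rb+ℓ≡jb (ℕₚ.m≤m+n rb ℓ)))

  -- Σ_{k<m} t^{krb} · Σ_{n∈A} tⁿ  and  Σ_{k<m} t^{(kr+1)b} · Σ_{n∈A} tⁿ, coefficientwise.
  E E' : ℕ → ℤ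
  E ℓ = Σℤ (map (λ k → shifted a (k * r * b) ℓ) (upTo m))
  E' ℓ = Σℤ (map (λ k → shifted a ((k * r + 1) * b) ℓ) (upTo m))

  conv-split : ∀ ℓ → conv c a ℓ ≡ E ℓ -ℤ E' ℓ
  conv-split ℓ = begin
      conv c a ℓ
    ≡⟨ conv-Σ (upTo m) (λ k j → δ (k * r * b) j -ℤ δ ((k * r + 1) * b) j) a ℓ ⟩
      Σℤ (map (λ k → conv (λ j → δ (k * r * b) j -ℤ δ ((k * r + 1) * b) j) a ℓ) (upTo m))
    ≡⟨ Σ-cong (upTo m) (λ k → trans (conv-- (δ (k * r * b)) (δ ((k * r + 1) * b)) a ℓ)
                                    (cong₂ _-ℤ_ (conv-monomial (k * r * b) a ℓ) (conv-monomial ((k * r + 1) * b) a ℓ))) ⟩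
      Σℤ (map (λ k → shifted a (k * r * b) ℓ -ℤ shifted a ((k * r + 1) * b) ℓ) (upTo m))
    ≡⟨ Σ-- (upTo m) (λ k → shifted a (k * r * b) ℓ) (λ k → shifted a ((k * r + 1) * b) ℓ) ⟩
      E ℓ -ℤ E' ℓ ∎
    where
    open ≡-Reasoning
    δ : ℕ → ℕ → ℤ
    δ s j = indicator (j ≡ᵇ s)

  [1+k]rb≡rb+krb : ∀ k → suc k * r * b ≡ rb + k * r * b
  [1+k]rb≡rb+krb k = ℕₚ.*-distribʳ-+ b r (k * r)

  E-below-rb : ∀ ℓ → ℓ < rb → E ℓ ≡ indicator (does (b ∣? ℓ))
  E-below-rb ℓ ℓ<rb = begin
      E ℓ
    ≡⟨ Σ<-front m' (λ k → shifted a (k * r * b) ℓ) ⟩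
      shifted a 0 ℓ +ℤ Σℤ (map (λ k → shifted a (suc k * r * b) ℓ) (upTo m'))
    ≡⟨ cong₂ _+ℤ_ (trans (shifted-yes a {0} {ℓ} z≤n) (cong indicator (allowed-below-rb ℓ ℓ<rb)))
                  (Σ-zero (upTo m') _ (λ k → shifted-no a (λ le → ℕₚ.<⇒≱ ℓ<rb (ℕₚ.≤-trans (rb≤ k) le)))) ⟩
      indicator (does (b ∣? ℓ)) +ℤ 0ℤ
    ≡⟨ ℤₚ.+-identityʳ _ ⟩
      indicator (does (b ∣? ℓ)) ∎
    where
    open ≡-Reasoning
    rb≤ : ∀ k → rb ≤ suc k * r * b
    rb≤ k = subst (rb ≤_) (sym ([1+k]rb≡rb+krb k)) (ℕₚ.m≤m+n rb _)

  -- E has period rb: the summands are rotated.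
  E-periodic : ∀ ℓ → E (rb + ℓ) ≡ E ℓ
  E-periodic ℓ = begin
      E (rb + ℓ)
    ≡⟨ Σ<-front m' (λ k → shifted a (k * r * b) (rb + ℓ)) ⟩
      shifted a 0 (rb + ℓ) +ℤ Σℤ (map (λ k → shifted a (suc k * r * b) (rb + ℓ)) (upTo m'))
    ≡⟨ cong₂ _+ℤ_ (trans (shifted-yes a {0} {rb + ℓ} z≤n) (allowed-after-rb ℓ))
                  (Σ-cong (upTo m') (λ k → trans (cong (λ s → shifted a s (rb + ℓ)) ([1+k]rb≡rb+krb k))
                                                 (shifted-+ a rb (k * r * b) ℓ))) ⟩
      shifted a (m' * r * b) ℓ +ℤ Σℤ (map (λ k → shifted a (k * r * b) ℓ) (upTo m'))
    ≡⟨ ℤₚ.+-comm (shifted a (m' * r * b) ℓ) _ ⟩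
      Σℤ (map (λ k → shifted a (k * r * b) ℓ) (upTo m')) +ℤ shifted a (m' * r * b) ℓ
    ≡⟨ sym (Σ<-back m' (λ k → shifted a (k * r * b) ℓ)) ⟩
      E ℓ ∎
    where open ≡-Reasoning

  E-divisibility : ∀ ℓ → E ℓ ≡ indicator (does (b ∣? ℓ))
  E-divisibility = <-rec _ step
    where
    step : ∀ ℓ → (∀ {k} → k < ℓ → E k ≡ indicator (does (b ∣? k))) → E ℓ ≡ indicator (does (b ∣? ℓ))
    step ℓ rec with ℓ <? rb
    ... | yes ℓ<rb = E-below-rb ℓ ℓ<rb
    ... | no ℓ≮rb with ℕₚ.m≤n⇒∃[o]m+o≡n (ℕₚ.≮⇒≥ ℓ≮rb)
    ...   | k , refl = trans (E-periodic k) (trans (rec (ℕₚ.m<n+m k (ℕₚ.*-monoˡ-< b {0} {r} (s≤s z≤n))))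
                                                 (cong indicator (does-⇔ b∣k⇔ (b ∣? k) (b ∣? rb + k))))
      where
      b∣k⇔ : b ∣ k ⇔ b ∣ rb + k
      b∣k⇔ = mk⇔ (∣m∣n⇒∣m+n (n∣m*n r)) (λ b∣rb+k → ∣m+n∣m⇒∣n b∣rb+k (n∣m*n r))

  [kr+1]b≡b+krb : ∀ k → (k * r + 1) * b ≡ b + k * r * b
  [kr+1]b≡b+krb k = expand k r b
    where
    expand : ∀ k r b → (k * r + 1) * b ≡ b + k * r * b
    expand = ℕSolver.solve-∀

  E'-shift : ∀ ℓ → E' (b + ℓ) ≡ E ℓ
  E'-shift ℓ = Σ-cong (upTo m) (λ k → trans (cong (λ s → shifted a s (b + ℓ)) ([kr+1]b≡b+krb k))
                                            (shifted-+ a b (k * r * b) ℓ))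

  E'-below-b : ∀ ℓ → ℓ < b → E' ℓ ≡ 0ℤ
  E'-below-b ℓ ℓ<b = Σ-zero (upTo m) _ (λ k → shifted-no a (λ le → ℕₚ.<⇒≱ ℓ<b (ℕₚ.≤-trans (b≤ k) le)))
    where
    b≤ : ∀ k → b ≤ (k * r + 1) * b
    b≤ k = subst (b ≤_) (sym ([kr+1]b≡b+krb k)) (ℕₚ.m≤m+n b _)

  c-zero : c 0 ≡ 1ℤ
  c-zero = trans (Σ<-front m' (λ k → indicator (0 ≡ᵇ k * r * b) -ℤ indicator (0 ≡ᵇ (k * r + 1) * b)))
                 (cong (1ℤ +ℤ_) (Σ-zero (upTo m') _ (λ _ → refl)))

  -- (Σ_{k<m} (t^{krb} − t^{(kr+1)b})) · A(t) = (1 − t^b)·Σ_{b ∣ ℓ} t^ℓ = 1.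
  conv-vanishes : ∀ n → conv c a (suc n) ≡ 0ℤ
  conv-vanishes n with b ≤? suc n
  ... | yes b≤1+n with ℕₚ.m≤n⇒∃[o]m+o≡n b≤1+n
  ...   | k , refl = begin
      conv c a (b + k)
    ≡⟨ conv-split (b + k) ⟩
      E (b + k) -ℤ E' (b + k)
    ≡⟨ cong₂ _-ℤ_ (trans (E-divisibility (b + k)) (cong indicator (does-⇔ b∣b+k⇔ (b ∣? b + k) (b ∣? k))))
                  (trans (E'-shift k) (E-divisibility k)) ⟩
      indicator (does (b ∣? k)) -ℤ indicator (does (b ∣? k))
    ≡⟨ ℤₚ.+-inverseʳ (indicator (does (b ∣? k))) ⟩
      0ℤ ∎
    where
    open ≡-Reasoning
    b∣b+k⇔ : b ∣ b + k ⇔ b ∣ k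
    b∣b+k⇔ = mk⇔ (λ b∣b+k → ∣m+n∣m⇒∣n b∣b+k ∣-refl) (∣m∣n⇒∣m+n ∣-refl)
  conv-vanishes n | no b≰1+n =
    trans (conv-split (suc n))
          (cong₂ _-ℤ_ (trans (E-divisibility (suc n)) (cong indicator (dec-false (b ∣? suc n) (b≰1+n ∘ ∣⇒≤))))
                      (E'-below-b (suc n) (ℕₚ.≰⇒> b≰1+n)))

proposition4 : (m b r : ℕ) → 1 ≤ m → 1 ≤ b → 1 ≤ r →
    (∀ w → (lhsSeries m b r *ₛ rhsSeries m b r) w ≡ oneₛ w) ×
    (∀ w → (rhsSeries m b r *ₛ lhsSeries m b r) w ≡ oneₛ w)
proposition4 (suc m') (suc b') (suc r') _ _ _ =
    (λ w → trans (*ₛ-congˡ I.R lhs≗hSum w) (proj₁ inverse w))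
  , (λ w → trans (*ₛ-congʳ I.R lhs≗hSum w) (proj₂ inverse w))
  where
  module P = Parameters m' b' r'
  module I = Inversion P.A P.allowed-zero
  lhs≗hSum : ∀ u → lhsSeries P.m P.b P.r u ≡ hSum P.c u
  lhs≗hSum = lhsSeries-hSum P.m P.b P.r
  inverse : (∀ w → (hSum P.c *ₛ I.R) w ≡ oneₛ w) × (∀ w → (I.R *ₛ hSum P.c) w ≡ oneₛ w)
  inverse = I.hSum-inverse P.c P.c-zero P.conv-vanishes
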